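{- Let $n$ be a positive integer and let $k$ be a nonnegative integer. Then the number $K_1$ of compositions of $n+2k+1$ in which exactly $k$ parts are equal to $1$ and all other parts are $\geq 2$ is \[K_1=\sum_{j_1+j_2+\cdots+j_{k+1}=n}f_{j_1}f_{j_2}\cdots f_{j_{k+1}},\] where the sum is over integers $j_t\geq -1$ ($t=1,\dots,k+1$) with $j_1+\cdots+j_{k+1}=n$, and $f_s$ are Fibonacci numbers.
   Context: The Fibonacci numbers are $f_0=0$, $f_1=1$, $f_s=f_{s-1}+f_{s-2}$, extended by $f_{ -1}=1$; with this indexing, for $m\ge 0$, $f_{m-1}$ is the number of compositions of $m$ with all parts $\geq 2$ (the empty composition counting for $m=0$). -}

module Defs where

open import Data.Nat using (ℕ; zero; suc; _+_; _*_; _∸_)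
open import Data.Integer as ℤ using (ℤ; +_; -[1+_])
open import Data.List using (List; []; _∷_; length; map; concatMap; filter; upTo)
open import Data.Nat.ListAction using (sum; product)
open import Data.Bool using (T?)
open import Data.Bool using (Bool; true; false)
open import Data.Nat using (_≡ᵇ_)

fibℕ : ℕ → ℕ
fibℕ zero = 0
fibℕ (suc zero) = 1
fibℕ (suc (suc s)) = fibℕ (suc s) + fibℕ s

-- Fibonacci numbers indexed by integers s ≥ -1, with f (-1) = 1.
-- (Only values at s ≥ -1 are ever used; for s ≤ -2 we return 0 arbitrarily.)
fib : ℤ → ℕ
fib (+ s) = fibℕ s
fib -[1+ zero ] = 1
fib -[1+ suc _ ] = 0

compsAux : (fuel : ℕ) → ℕ → List (List ℕ)
compsAux _ zero = [] ∷ []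
compsAux zero (suc m) = []
compsAux (suc fuel) (suc m) =
  concatMap (λ i → map (suc i ∷_) (compsAux fuel (m ∸ i))) (upTo (suc m))

compositions : ℕ → List (List ℕ)
compositions m = compsAux m m

onesCount : List ℕ → ℕ
onesCount [] = 0
onesCount (suc zero ∷ xs) = suc (onesCount xs)
onesCount (_ ∷ xs) = onesCount xs

othersAtLeast2 : List ℕ → Bool
othersAtLeast2 [] = true
othersAtLeast2 (zero ∷ xs) = false
othersAtLeast2 (suc _ ∷ xs) = othersAtLeast2 xs

good : ℕ → List ℕ → Bool
good k c with onesCount c ≡ᵇ k
... | true = othersAtLeast2 c
... | false = false

countCompsKOnes : (m k : ℕ) → ℕ
countCompsKOnes m k = length (filter (λ c → T? (good k c)) (compositions m))

-- All lists (j₁,…,j_len) of integers with every jₜ ≥ -1 and j₁+⋯+j_len = total.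
-- Enumerated via the shift iₜ = jₜ + 1 ≥ 0, Σ iₜ = total + len.
weakTuples : (len : ℕ) → ℕ → List (List ℕ)
weakTuples zero zero = [] ∷ []
weakTuples zero (suc _) = []
weakTuples (suc len) t = concatMap (λ i → map (i ∷_) (weakTuples len (t ∸ i))) (upTo (suc t))

tuplesFrom-1 : (len : ℕ) → (total : ℕ) → List (List ℤ)
tuplesFrom-1 len t = map (map (λ i → (+ i) ℤ.- (+ 1))) (weakTuples len (t + len))

fibConvolution : (k n : ℕ) → ℕ
fibConvolution k n = sum (map (λ js → product (map fib js)) (tuplesFrom-1 (suc k) n))

module Submission where

-- Write F s = f_{s-1}; F s is the number of compositions of s
-- into parts ≥ 2.  A composition with exactly k ones is cut by its ones into
-- k+1 (possibly empty) blocks of parts ≥ 2, so the count K k m of such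
-- compositions of m is the (k+1)-fold convolution of F with a 1 between
-- consecutive blocks; this is how K is defined below.

open import Defs
open import Data.Nat using (ℕ; zero; suc; _+_; _*_; _∸_; _≤_; _<_; z≤n; s≤s; NonZero; _≡ᵇ_)
open import Data.Nat.Properties
  using (+-identityʳ; +-assoc; +-suc; +-cancelʳ-≡; *-identityˡ; *-identityʳ; *-zeroʳ; *-distribˡ-+; *-distribʳ-+;
         ≤-refl; ≤-trans; ≤-pred; ≤-<-trans; m∸n≤m; n∸n≡0; ∸-monoʳ-<; m<n⇒0<n∸m; +-∸-comm; [m+n]∸[m+o]≡n∸o)
import Data.Integer as ℤ
open import Data.List using (List; []; _∷_; length; map; concatMap; filter; upTo; applyUpTo; _++_)
open import Data.List.Properties using (map-∘; map-cong; map-++)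
open import Data.Nat.ListAction using (sum; product)
open import Data.Nat.ListAction.Properties using (sum-++)
open import Data.Bool using (Bool; true; false; T?; if_then_else_)
open import Data.Nat.Tactic.RingSolver using (solve-∀)
open import Relation.Binary.PropositionalEquality using (_≡_; refl; sym; trans; cong; cong₂; module ≡-Reasoning)
open ≡-Reasoning

-- Finite sums g 0 + g 1 + ⋯ + g (m - 1), recursing on the first term, so
-- that shifting the summation index (i ↦ suc i) is definitional.
∑< : ℕ → (ℕ → ℕ) → ℕ
∑< zero    g = 0
∑< (suc m) g = g 0 + ∑< m (λ i → g (suc i))

-- The summand extends over products but not over sums.
infixr 6.5 ∑<
syntax ∑< m (λ i → e) = ∑[ i < m ] e

∑-cong : ∀ {g h : ℕ → ℕ} m → (∀ i → i < m → g i ≡ h i) → ∑[ i < m ] g i ≡ ∑[ i < m ] h i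
∑-cong zero    _  = refl
∑-cong (suc m) eq = cong₂ _+_ (eq 0 (s≤s z≤n)) (∑-cong m (λ i i<m → eq (suc i) (s≤s i<m)))

∑-zero : ∀ {g : ℕ → ℕ} m → (∀ i → i < m → g i ≡ 0) → ∑[ i < m ] g i ≡ 0
∑-zero zero    _  = refl
∑-zero (suc m) eq = cong₂ _+_ (eq 0 (s≤s z≤n)) (∑-zero m (λ i i<m → eq (suc i) (s≤s i<m)))

∑-+ : ∀ (g h : ℕ → ℕ) m → ∑[ i < m ] (g i + h i) ≡ ∑[ i < m ] g i + ∑[ i < m ] h i
∑-+ g h zero    = refl
∑-+ g h (suc m) = begin
  g 0 + h 0 + ∑[ i < m ] (g (suc i) + h (suc i))         ≡⟨ cong (g 0 + h 0 +_) (∑-+ (λ i → g (suc i)) (λ i → h (suc i)) m) ⟩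
  g 0 + h 0 + (∑[ i < m ] g (suc i) + ∑[ i < m ] h (suc i)) ≡⟨ interchange (g 0) (h 0) _ _ ⟩
  g 0 + ∑[ i < m ] g (suc i) + (h 0 + ∑[ i < m ] h (suc i)) ∎
  where
  interchange : ∀ a b c d → a + b + (c + d) ≡ a + c + (b + d)
  interchange = solve-∀

∑-split : ∀ (g : ℕ → ℕ) a b → ∑[ i < a + b ] g i ≡ ∑[ i < a ] g i + ∑[ i < b ] g (a + i)
∑-split g zero    b = refl
∑-split g (suc a) b = begin
  g 0 + ∑[ i < a + b ] g (suc i)                          ≡⟨ cong (g 0 +_) (∑-split (λ i → g (suc i)) a b) ⟩
  g 0 + (∑[ i < a ] g (suc i) + ∑[ i < b ] g (suc a + i)) ≡⟨ sym (+-assoc (g 0) _ _) ⟩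
  g 0 + ∑[ i < a ] g (suc i) + ∑[ i < b ] g (suc a + i)   ∎

∑-last : ∀ (g : ℕ → ℕ) m → ∑[ i < suc m ] g i ≡ ∑[ i < m ] g i + g m
∑-last g zero    = +-identityʳ (g 0)
∑-last g (suc m) = trans (cong (g 0 +_) (∑-last (λ i → g (suc i)) m)) (sym (+-assoc (g 0) _ _))

sum-map-applyUpTo : ∀ (h f : ℕ → ℕ) m → sum (map h (applyUpTo f m)) ≡ ∑[ i < m ] h (f i)
sum-map-applyUpTo h f zero    = refl
sum-map-applyUpTo h f (suc m) = cong (h (f 0) +_) (sum-map-applyUpTo h (λ i → f (suc i)) m)

sum-map-concatMap : ∀ {A B : Set} (g : B → ℕ) (f : A → List B) xs →
  sum (map g (concatMap f xs)) ≡ sum (map (λ x → sum (map g (f x))) xs)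
sum-map-concatMap g f []       = refl
sum-map-concatMap g f (x ∷ xs) = begin
  sum (map g (f x ++ concatMap f xs))                ≡⟨ cong sum (map-++ g (f x) _) ⟩
  sum (map g (f x) ++ map g (concatMap f xs))        ≡⟨ sum-++ (map g (f x)) _ ⟩
  sum (map g (f x)) + sum (map g (concatMap f xs))   ≡⟨ cong (sum (map g (f x)) +_) (sum-map-concatMap g f xs) ⟩
  sum (map g (f x)) + sum (map (λ x → sum (map g (f x))) xs) ∎

sum-map-scale : ∀ {A : Set} c (g : A → ℕ) xs → sum (map (λ x → c * g x) xs) ≡ c * sum (map g xs)
sum-map-scale c g []       = sym (*-zeroʳ c)
sum-map-scale c g (x ∷ xs) = trans (cong (c * g x +_) (sum-map-scale c g xs)) (sym (*-distribˡ-+ c (g x) _))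

length-filter-indicator : ∀ {A : Set} (b : A → Bool) xs →
  length (filter (λ x → T? (b x)) xs) ≡ sum (map (λ x → if b x then 1 else 0) xs)
length-filter-indicator b []       = refl
length-filter-indicator b (x ∷ xs) with b x
... | true  = cong suc (length-filter-indicator b xs)
... | false = length-filter-indicator b xs

oneFewer : {A : Set} → (ℕ → A → ℕ) → ℕ → A → ℕ
oneFewer R zero    x = 0
oneFewer R (suc k) x = R k x

-- Splitting off the first part of a composition of suc m: it is either a 1,
-- followed by a composition of m with one fewer 1, or a part suc (suc i),
-- followed by a composition of m - 1 - i.
record FirstPartRecurrence (R : ℕ → ℕ → ℕ) : Set where
  field
    empty-noOnes : R 0 0 ≡ 1
    empty-ones   : ∀ k → R (suc k) 0 ≡ 0
    firstPart    : ∀ k m → R k (suc m) ≡ oneFewer R k m + ∑[ i < m ] R k (m ∸ suc i)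

goodInd : ℕ → List ℕ → ℕ
goodInd k c = if good k c then 1 else 0

countGood : ℕ → List (List ℕ) → ℕ
countGood k cs = sum (map (goodInd k) cs)

goodInd-big : ∀ k i c → goodInd k (suc (suc i) ∷ c) ≡ goodInd k c
goodInd-big k i c with onesCount c ≡ᵇ k
... | true  = refl
... | false = refl

goodInd-one : ∀ k c → goodInd (suc k) (1 ∷ c) ≡ goodInd k c
goodInd-one k c with onesCount c ≡ᵇ k
... | true  = refl
... | false = refl

countGood-big : ∀ k i cs → countGood k (map (suc (suc i) ∷_) cs) ≡ countGood k cs
countGood-big k i cs = cong sum (trans (sym (map-∘ cs)) (map-cong (goodInd-big k i) cs))

countGood-one : ∀ k cs → countGood k (map (1 ∷_) cs) ≡ oneFewer countGood k cs
countGood-one zero    []       = refl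
countGood-one zero    (c ∷ cs) = countGood-one zero cs
countGood-one (suc k) cs       = cong sum (trans (sym (map-∘ cs)) (map-cong (goodInd-one k) cs))

count-unique : ∀ {R} → FirstPartRecurrence R → ∀ fuel m k → m ≤ fuel → countGood k (compsAux fuel m) ≡ R k m
count-unique rec fuel zero zero    _ = sym (FirstPartRecurrence.empty-noOnes rec)
count-unique rec fuel zero (suc k) _ = sym (FirstPartRecurrence.empty-ones rec k)
count-unique {R} rec (suc f) (suc m) k (s≤s m≤f) = begin
  countGood k (concatMap branch (upTo (suc m)))
    ≡⟨ sum-map-concatMap (goodInd k) branch (upTo (suc m)) ⟩
  sum (map (λ i → countGood k (branch i)) (upTo (suc m)))
    ≡⟨ sum-map-applyUpTo (λ i → countGood k (branch i)) (λ i → i) (suc m) ⟩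
  countGood k (map (1 ∷_) (compsAux f m)) + ∑[ i < m ] countGood k (branch (suc i))
    ≡⟨ cong₂ _+_ (trans (countGood-one k (compsAux f m)) (leadingOne k)) (∑-cong m leadingBig) ⟩
  oneFewer R k m + ∑[ i < m ] R k (m ∸ suc i)
    ≡⟨ sym (FirstPartRecurrence.firstPart rec k m) ⟩
  R k (suc m) ∎
  where
  branch : ℕ → List (List ℕ)
  branch i = map (suc i ∷_) (compsAux f (m ∸ i))
  leadingOne : ∀ k → oneFewer countGood k (compsAux f m) ≡ oneFewer R k m
  leadingOne zero    = refl
  leadingOne (suc k) = count-unique rec f m k m≤f
  leadingBig : ∀ i → i < m → countGood k (branch (suc i)) ≡ R k (m ∸ suc i)
  leadingBig i _ = trans (countGood-big k i (compsAux f (m ∸ suc i)))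
                         (count-unique rec f (m ∸ suc i) k (≤-trans (m∸n≤m m (suc i)) m≤f))

firstPart-from-secondOrder : ∀ {R : ℕ → ℕ → ℕ} →
  (∀ k → R k 1 ≡ oneFewer R k 0) →
  (∀ k m → R k (suc (suc m)) + oneFewer R k m ≡ oneFewer R k (suc m) + R k (suc m) + R k m) →
  ∀ k m → R k (suc m) ≡ oneFewer R k m + ∑[ i < m ] R k (m ∸ suc i)
firstPart-from-secondOrder {R} atOne secondOrder k zero = trans (atOne k) (sym (+-identityʳ _))
firstPart-from-secondOrder {R} atOne secondOrder k (suc m) = +-cancelʳ-≡ (oneFewer R k m) _ _ (begin
  R k (suc (suc m)) + oneFewer R k m                   ≡⟨ secondOrder k m ⟩
  oneFewer R k (suc m) + R k (suc m) + R k m          ≡⟨ cong (λ x → oneFewer R k (suc m) + x + R k m) ih ⟩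
  oneFewer R k (suc m) + (oneFewer R k m + S) + R k m ≡⟨ rearrange (oneFewer R k (suc m)) (oneFewer R k m) S (R k m) ⟩
  oneFewer R k (suc m) + (R k m + S) + oneFewer R k m ∎)
  where
  S : ℕ
  S = ∑[ i < m ] R k (m ∸ suc i)
  ih : R k (suc m) ≡ oneFewer R k m + S
  ih = firstPart-from-secondOrder atOne secondOrder k m
  rearrange : ∀ a b s r → a + (b + s) + r ≡ a + (r + s) + b
  rearrange = solve-∀

-- Shifted Fibonacci numbers F s = f_{s-1}: compositions of s into parts ≥ 2.
F : ℕ → ℕ
F zero    = 1
F (suc s) = fibℕ s

-- The Fibonacci recurrence, valid for F from index 0 on since f_{-1} = 1.
F-rec : ∀ s → F (suc (suc s)) ≡ F (suc s) + F s
F-rec zero    = refl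
F-rec (suc s) = refl

-- K k m: choose the first block (sum a, F a ways), then a 1, then a
-- composition of the remaining m - 1 - a with k - 1 further ones.
K : ℕ → ℕ → ℕ
K zero    m = F m
K (suc k) m = ∑[ a < m ] F a * K k (m ∸ suc a)

-- The only compositions of 1 are (1): K k 1 is 1 exactly for k = 1.
K-atOne : ∀ k → K k 1 ≡ oneFewer K k 0
K-atOne zero    = refl
K-atOne (suc k) = trans (+-identityʳ _) (*-identityˡ (K k 0))

-- Fibonacci recurrence for K, corrected by the blocks ending just before a 1.
K-secondOrder : ∀ k m → K k (suc (suc m)) + oneFewer K k m ≡ oneFewer K k (suc m) + K k (suc m) + K k m
K-secondOrder zero    m = trans (+-identityʳ _) (F-rec m)
K-secondOrder (suc k) m = begin
  1 * K k (suc m) + ∑[ a < m ] F (suc (suc a)) * L a + K k m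
    ≡⟨ cong (λ x → 1 * K k (suc m) + x + K k m) splitF ⟩
  1 * K k (suc m) + (X + K (suc k) m) + K k m
    ≡⟨ rearrange (K k (suc m)) X (K (suc k) m) (K k m) ⟩
  K k (suc m) + (1 * K k m + X) + K (suc k) m ∎
  where
  L : ℕ → ℕ
  L a = K k (m ∸ suc a)
  X : ℕ
  X = ∑[ a < m ] F (suc a) * L a
  splitF : ∑[ a < m ] F (suc (suc a)) * L a ≡ X + K (suc k) m
  splitF = trans (∑-cong m (λ a _ → trans (cong (_* L a) (F-rec a)) (*-distribʳ-+ (L a) (F (suc a)) (F a))))
                 (∑-+ (λ a → F (suc a) * L a) (λ a → F a * L a) m)
  rearrange : ∀ p x y q → 1 * p + (x + y) + q ≡ p + (1 * q + x) + y
  rearrange = solve-∀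

K-firstPart : FirstPartRecurrence K
K-firstPart = record
  { empty-noOnes = refl
  ; empty-ones   = λ _ → refl
  ; firstPart    = firstPart-from-secondOrder K-atOne K-secondOrder
  }

-- A composition of m has at most m ones.
K-below : ∀ k m → m < k → K k m ≡ 0
K-below (suc k) zero    _         = refl
K-below (suc k) (suc m) (s≤s m<k) = ∑-zero (suc m) (λ a _ →
  trans (cong (F a *_) (K-below k (m ∸ a) (≤-<-trans (m∸n≤m m a) m<k))) (*-zeroʳ (F a)))

fibTupleSum : ℕ → ℕ → ℕ
fibTupleSum len t = sum (map (λ is → product (map F is)) (weakTuples len t))

fibTupleSum-step : ∀ len t → fibTupleSum (suc len) t ≡ ∑[ i < suc t ] F i * fibTupleSum len (t ∸ i)
fibTupleSum-step len t = begin
  sum (map φ (concatMap tuplesFrom (upTo (suc t))))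
    ≡⟨ sum-map-concatMap φ tuplesFrom (upTo (suc t)) ⟩
  sum (map (λ i → sum (map φ (tuplesFrom i))) (upTo (suc t)))
    ≡⟨ sum-map-applyUpTo (λ i → sum (map φ (tuplesFrom i))) (λ i → i) (suc t) ⟩
  ∑[ i < suc t ] sum (map φ (tuplesFrom i))
    ≡⟨ ∑-cong (suc t) (λ i _ → trans (cong sum (sym (map-∘ {g = φ} {f = i ∷_} (weakTuples len (t ∸ i)))))
                                     (sum-map-scale (F i) φ (weakTuples len (t ∸ i)))) ⟩
  ∑[ i < suc t ] F i * fibTupleSum len (t ∸ i) ∎
  where
  φ : List ℕ → ℕ
  φ is = product (map F is)
  tuplesFrom : ℕ → List (List ℕ)
  tuplesFrom i = map (i ∷_) (weakTuples len (t ∸ i))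

fibTupleSum-one : ∀ t → fibTupleSum 1 t ≡ F t
fibTupleSum-one t = begin
  fibTupleSum 1 t                                             ≡⟨ fibTupleSum-step 0 t ⟩
  ∑[ i < suc t ] F i * fibTupleSum 0 (t ∸ i)                  ≡⟨ ∑-last (λ i → F i * fibTupleSum 0 (t ∸ i)) t ⟩
  ∑[ i < t ] F i * fibTupleSum 0 (t ∸ i) + F t * fibTupleSum 0 (t ∸ t)
    ≡⟨ cong₂ _+_ (∑-zero t (λ i i<t → trans (cong (F i *_) (emptyTuples (m<n⇒0<n∸m i<t))) (*-zeroʳ (F i))))
                 (cong (λ x → F t * fibTupleSum 0 x) (n∸n≡0 t)) ⟩
  F t * 1                                                     ≡⟨ *-identityʳ (F t) ⟩
  F t ∎
  where
  emptyTuples : ∀ {s} → 0 < s → fibTupleSum 0 s ≡ 0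
  emptyTuples {suc s} _ = refl

K-tuples : ∀ k t → K k (t + k) ≡ fibTupleSum (suc k) t
K-tuples zero    t = trans (cong F (+-identityʳ t)) (sym (fibTupleSum-one t))
K-tuples (suc k) t = begin
  K (suc k) (t + suc k)
    ≡⟨ cong (K (suc k)) (+-suc t k) ⟩
  ∑[ a < suc t + k ] F a * K k (t + k ∸ a)
    ≡⟨ ∑-split (λ a → F a * K k (t + k ∸ a)) (suc t) k ⟩
  ∑[ a < suc t ] F a * K k (t + k ∸ a) + ∑[ i < k ] F (suc t + i) * K k (t + k ∸ (suc t + i))
    ≡⟨ cong₂ _+_ (∑-cong (suc t) blockFits) (∑-zero k tooLate) ⟩
  ∑[ a < suc t ] F a * fibTupleSum (suc k) (t ∸ a) + 0
    ≡⟨ trans (+-identityʳ _) (sym (fibTupleSum-step (suc k) t)) ⟩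
  fibTupleSum (suc (suc k)) t ∎
  where
  blockFits : ∀ a → a < suc t → F a * K k (t + k ∸ a) ≡ F a * fibTupleSum (suc k) (t ∸ a)
  blockFits a a<st = cong (F a *_) (trans (cong (K k) (+-∸-comm k (≤-pred a<st))) (K-tuples k (t ∸ a)))
  tooLate : ∀ i → i < k → F (suc t + i) * K k (t + k ∸ (suc t + i)) ≡ 0
  tooLate i i<k = begin
    F (suc t + i) * K k (t + k ∸ (suc t + i)) ≡⟨ cong (λ x → F (suc t + i) * K k (t + k ∸ x)) (sym (+-suc t i)) ⟩
    F (suc t + i) * K k (t + k ∸ (t + suc i)) ≡⟨ cong (λ x → F (suc t + i) * K k x) ([m+n]∸[m+o]≡n∸o t k (suc i)) ⟩
    F (suc t + i) * K k (k ∸ suc i)           ≡⟨ cong (F (suc t + i) *_) (K-below k (k ∸ suc i) (∸-monoʳ-< (s≤s z≤n) i<k)) ⟩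
    F (suc t + i) * 0                         ≡⟨ *-zeroʳ (F (suc t + i)) ⟩
    0 ∎

fib-shift : ∀ i → fib (ℤ.+ i ℤ.- ℤ.+ 1) ≡ F i
fib-shift zero    = refl
fib-shift (suc i) = refl

fibConvolution-tuples : ∀ k n → fibConvolution k n ≡ fibTupleSum (suc k) (n + suc k)
fibConvolution-tuples k n = cong sum (trans (sym (map-∘ (weakTuples (suc k) (n + suc k))))
  (map-cong (λ is → cong product (trans (sym (map-∘ is)) (map-cong fib-shift is))) (weakTuples (suc k) (n + suc k))))

-- The theorem: with m = n + 2k + 1 and
-- t = n + k + 1 we have m = t + k, so K₁ = K k (t + k) = fibTupleSum (k+1) t.
corollary3 : (n k : ℕ) → .{{_ : NonZero n}} →
    countCompsKOnes (n + 2 * k + 1) k ≡ fibConvolution k n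
corollary3 n k = begin
  countCompsKOnes M k                   ≡⟨ length-filter-indicator (good k) (compositions M) ⟩
  countGood k (compsAux M M)            ≡⟨ count-unique K-firstPart M M k ≤-refl ⟩
  K k M                                 ≡⟨ cong (K k) (regroup n k) ⟩
  K k (n + suc k + k)                   ≡⟨ K-tuples k (n + suc k) ⟩
  fibTupleSum (suc k) (n + suc k)       ≡⟨ sym (fibConvolution-tuples k n) ⟩
  fibConvolution k n ∎
  where
  M : ℕ
  M = n + 2 * k + 1
  regroup : ∀ n k → n + 2 * k + 1 ≡ n + suc k + k
  regroup = solve-∀
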